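{- Let $\pi\in S_n$ have LTR-max decomposition $\pi=M_1P_1M_2$ with $m_1=|M_1|$, $p_1=|P_1|$. If $|M_2|=2$ then $|q^{ -1}(\pi)|=C_{m_1+1}+(p_1+1)C_{m_1}$. If $|M_2|=3$ then $|q^{ -1}(\pi)|=C_{m_1+2}+(p_1+1)C_{m_1+1}+\frac12(p_1+1)(p_1+4)C_{m_1}$. Here $C_r=\frac{1}{r+1}\binom{2r}{r}$.
   Context: $S_n$ is the set of permutations of $\{1,\dots,n\}$ in one-line notation. An entry $\pi_i$ is a left-to-right (LTR) maximum if $\pi_i>\pi_j$ for all $j<i$. The map $q:S_n\to S_n$ (the algorithm Queuesort, sorting with a queue allowing bypass): let $m_1,\dots,m_r$ be the LTR maxima of $\pi$ from left to right; for $i=r,\dots,1$ in this order, repeatedly swap $m_i$ with the entry immediately to its right as long as such an entry exists and is smaller than $m_i$; the result is $q(\pi)$. $q^{ -1}(\pi)=\{\sigma: q(\sigma)=\pi\}$. The LTR-max decomposition $\pi=M_1P_1M_2$ means: $M_1$ is the maximal initial factor of consecutive LTR maxima, $P_1$ is a nonempty factor of non-LTR-maxima, and $M_2$ is the final factor consisting of LTR maxima, and these are all the LTR maxima. -}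

module Defs where

open import Data.Nat using (ℕ; zero; suc; _+_; _*_; _<ᵇ_; _≡ᵇ_; _<_)
open import Data.Nat.Combinatorics using (_C_)
open import Data.Nat.DivMod using (_/_)
open import Data.Bool using (Bool; true; false; if_then_else_)
open import Data.List using (List; []; _∷_; map; reverse; foldl; upTo)
open import Data.Maybe using (Maybe; just; nothing)
open import Data.Product using (_×_)
open import Relation.Binary.PropositionalEquality using (_≡_)
open import Data.List.Relation.Binary.Permutation.Propositional using (_↭_)
open import Data.List.Relation.Unary.Unique.Propositional using (Unique)
open import Data.List.Membership.Propositional using (_∈_)
open import Function.Bundles using (_⇔_)

-- σ ∈ S_n : σ is a rearrangement of [1, 2, ..., n] (one-line notation)
IsPerm : ℕ → List ℕ → Set
IsPerm n σ = σ ↭ map suc (upTo n)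

-- The left-to-right maxima of a list, in left-to-right order.
-- The argument is the maximum of the entries seen so far (nothing = no entry yet).
ltrMaxGo : Maybe ℕ → List ℕ → List ℕ
ltrMaxGo _ [] = []
ltrMaxGo nothing (x ∷ xs) = x ∷ ltrMaxGo (just x) xs
ltrMaxGo (just m) (x ∷ xs) = if m <ᵇ x then x ∷ ltrMaxGo (just x) xs else ltrMaxGo (just m) xs

ltrMax : List ℕ → List ℕ
ltrMax = ltrMaxGo nothing

pushRight : ℕ → List ℕ → List ℕ
pushRight v [] = v ∷ []
pushRight v (x ∷ xs) = if x <ᵇ v then x ∷ pushRight v xs else v ∷ x ∷ xs

bubble : ℕ → List ℕ → List ℕ
bubble v [] = []
bubble v (x ∷ xs) = if x ≡ᵇ v then pushRight v xs else x ∷ bubble v xs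

-- Queuesort: for i = r, ..., 1 bubble the LTR maximum m_i
q : List ℕ → List ℕ
q π = foldl (λ acc m → bubble m acc) π (reverse (ltrMax π))

-- L is a duplicate-free enumeration of q⁻¹(π) ⊆ S_n
-- (so |q⁻¹(π)| = length L)
EnumPreimage : ℕ → List ℕ → List (List ℕ) → Set
EnumPreimage n π L = Unique L × (∀ σ → (σ ∈ L) ⇔ (IsPerm n σ × q σ ≡ π))

catalan : ℕ → ℕ
catalan r = ((2 * r) C r) / suc r

module Submission where

-- Write a preimage as σ = m ∷ B ++ σ′, where B collects the entries after m that are smaller than m.
-- Then m is the smallest LTR maximum of σ and is bubbled last, so q σ = B ++ pushRight m (q σ′).
-- Read backwards, this enumerates q⁻¹(π) recursively: choose the first entry m of σ among the entries
-- of π that exceed everything before them and are not followed by a smaller entry, choose the prefix B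
-- of what precedes m in π, and choose a preimage σ′ of the rest.  For π = M₁ P₁ M₂ the possible first
-- entries are the LTR maxima other than the last entry of M₁, and the counts satisfy the recursion of
-- Catalan's triangle, whose first column consists of the Catalan numbers.

open import Defs
open import Data.Bool using (true; false; T; if_then_else_)
open import Data.Bool.Properties using (T-≡)
open import Data.Empty using (⊥; ⊥-elim)
open import Data.List using (List; []; _∷_; _++_; [_]; _∷ʳ_; length; map; foldl; reverse; initLast; _∷ʳ′_)
open import Data.List.Properties
  using (++-assoc; ++-identityʳ; ++-cancelˡ; ++-conicalˡ; ++-conicalʳ; ∷-injectiveˡ; ∷-injectiveʳ;
         foldl-++; unfold-reverse; length-++; length-++-sucʳ; length-map)
open import Data.List.Relation.Unary.All using (All; []; _∷_; all?)
open import Data.List.Relation.Unary.Any using (here; there)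
open import Data.List.Membership.Propositional using (_∈_)
open import Data.List.Membership.Propositional.Properties using (∈-++⁺ˡ; ∈-++⁺ʳ; ∈-++⁻; ∈-map⁺; ∈-map⁻)
open import Data.List.Relation.Unary.All.Properties using (++⁺; ++⁻ˡ; ++⁻ʳ; map⁺)
import Data.List.Relation.Unary.All as All
open import Data.List.Relation.Unary.Linked using (Linked; []; [-]; _∷_)
open import Data.List.Relation.Binary.Permutation.Propositional using (_↭_; ↭-refl; ↭-sym; ↭-trans; ↭-prep; ↭-swap; ↭⇒↭ₛ)
open import Data.List.Membership.Propositional.Properties.WithK using (unique∧set⇒bag)
open import Data.List.Relation.Binary.BagAndSetEquality using (∼bag⇒↭)
open import Data.List.Relation.Binary.Permutation.Propositional.Properties using (All-resp-↭; ↭-reverse; ↭-length)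
open import Data.List.Relation.Unary.Unique.Propositional using (Unique)
import Data.List.Relation.Unary.Unique.Propositional.Properties as Unique
open import Data.List.Relation.Unary.Unique.Propositional.Properties using (Unique[x∷xs]⇒x∉xs)
open import Data.List.Relation.Binary.Disjoint.Propositional using (Disjoint)
open import Data.List.Relation.Unary.AllPairs using ([]; _∷_)
open import Data.Maybe using (just)
open import Data.Nat
open import Data.Nat.Properties
open import Data.Nat.Combinatorics using (_C_; nCk+nC[k+1]≡[n+1]C[k+1]; nCk≡nC[n∸k]; nC1≡n)
open import Data.Nat.DivMod using (_/_; m*n/n≡m)
open import Data.Nat.Tactic.RingSolver using (solve-∀)
open import Algebra.Properties.CommutativeSemigroup +-commutativeSemigroup using () renaming (interchange to +-interchange)
open import Data.Product using (Σ; _×_; _,_; proj₁)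
open import Data.Sum using (inj₁; inj₂)
open import Data.Unit using (⊤; tt)
open import Function.Base using (_∘_)
open import Function.Bundles using (Equivalence; mk⇔)
open import Function.Construct.Composition using (_⇔-∘_)
open import Function.Construct.Symmetry using (⇔-sym)
open import Relation.Nullary using (¬_; Dec; yes; no)
open import Relation.Nullary.Decidable using (_×-dec_)
open import Relation.Binary.PropositionalEquality hiding ([_])
import Data.List.Relation.Binary.Permutation.Setoid.Properties (setoid ℕ) as ↭ₛ

<ᵇ-true : ∀ {m n} → m < n → (m <ᵇ n) ≡ true
<ᵇ-true m<n = Equivalence.to T-≡ (<⇒<ᵇ m<n)

<ᵇ-false : ∀ {m n} → ¬ m < n → (m <ᵇ n) ≡ false
<ᵇ-false {m} {n} m≮n with m <ᵇ n in eq
... | true  = ⊥-elim (m≮n (<ᵇ⇒< m n (Equivalence.from T-≡ eq)))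
... | false = refl

≡ᵇ-refl : ∀ m → (m ≡ᵇ m) ≡ true
≡ᵇ-refl m = Equivalence.to T-≡ (≡⇒≡ᵇ m m refl)

≡ᵇ-false : ∀ {m n} → m ≢ n → (m ≡ᵇ n) ≡ false
≡ᵇ-false {m} {n} m≢n with m ≡ᵇ n in eq
... | true  = ⊥-elim (m≢n (≡ᵇ⇒≡ m n (Equivalence.from T-≡ eq)))
... | false = refl

StartsAbove : ℕ → List ℕ → Set
StartsAbove m []      = ⊤
StartsAbove m (x ∷ _) = m < x

StartsAtLeast : ℕ → List ℕ → Set
StartsAtLeast m []      = ⊤
StartsAtLeast m (x ∷ _) = m ≤ x

Ascending : ℕ → List ℕ → Set
Ascending t xs = Linked _<_ (t ∷ xs)

-- Queuesort

ltrMaxGo-below : ∀ m B σ → All (_< m) B → ltrMaxGo (just m) (B ++ σ) ≡ ltrMaxGo (just m) σ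
ltrMaxGo-below m []      σ []           = refl
ltrMaxGo-below m (b ∷ B) σ (b<m ∷ B<m) rewrite <ᵇ-false (<⇒≯ b<m) = ltrMaxGo-below m B σ B<m

ltrMaxGo-above : ∀ m σ → StartsAbove m σ → ltrMaxGo (just m) σ ≡ ltrMax σ
ltrMaxGo-above m []      _   = refl
ltrMaxGo-above m (x ∷ σ) m<x rewrite <ᵇ-true m<x = refl

ltrMax-∷ : ∀ m B σ → All (_< m) B → StartsAbove m σ → ltrMax (m ∷ B ++ σ) ≡ m ∷ ltrMax σ
ltrMax-∷ m B σ B<m m<σ = cong (m ∷_) (trans (ltrMaxGo-below m B σ B<m) (ltrMaxGo-above m σ m<σ))

ltrMaxGo-exceeds : ∀ m c σ → m ≤ c → All (m <_) (ltrMaxGo (just c) σ)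
ltrMaxGo-exceeds m c []      _   = []
ltrMaxGo-exceeds m c (x ∷ σ) m≤c with c <ᵇ x in eq
... | true  = m<x ∷ ltrMaxGo-exceeds m x σ (<⇒≤ m<x)
  where m<x = ≤-<-trans m≤c (<ᵇ⇒< c x (Equivalence.from T-≡ eq))
... | false = ltrMaxGo-exceeds m c σ m≤c

ltrMax-exceeds : ∀ m σ → StartsAbove m σ → All (m <_) (ltrMax σ)
ltrMax-exceeds m []      _   = []
ltrMax-exceeds m (x ∷ σ) m<x = m<x ∷ ltrMaxGo-exceeds m x σ (<⇒≤ m<x)

bubbleAll : List ℕ → List ℕ → List ℕ
bubbleAll σ vs = foldl (λ acc v → bubble v acc) σ vs

bubble-skip : ∀ v P σ → All (_≢ v) P → bubble v (P ++ σ) ≡ P ++ bubble v σ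
bubble-skip v []      σ []            = refl
bubble-skip v (x ∷ P) σ (x≢v ∷ P≢v) rewrite ≡ᵇ-false x≢v = cong (x ∷_) (bubble-skip v P σ P≢v)

bubbleAll-skip : ∀ m B σ vs → All (_< m) B → All (m <_) vs →
                 bubbleAll (m ∷ B ++ σ) vs ≡ m ∷ B ++ bubbleAll σ vs
bubbleAll-skip m B σ []       _   _            = refl
bubbleAll-skip m B σ (v ∷ vs) B<m (m<v ∷ m<vs) =
  trans (cong (λ τ → bubbleAll τ vs) (bubble-skip v (m ∷ B) σ (<⇒≢ m<v ∷ All.map (λ b<m → <⇒≢ (<-trans b<m m<v)) B<m)))
        (bubbleAll-skip m B (bubble v σ) vs B<m m<vs)

pushRight-below : ∀ m B σ → All (_< m) B → pushRight m (B ++ σ) ≡ B ++ pushRight m σ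
pushRight-below m []      σ []           = refl
pushRight-below m (b ∷ B) σ (b<m ∷ B<m) rewrite <ᵇ-true b<m = cong (b ∷_) (pushRight-below m B σ B<m)

pushRight-stop : ∀ m σ → StartsAtLeast m σ → pushRight m σ ≡ m ∷ σ
pushRight-stop m []      _   = refl
pushRight-stop m (x ∷ σ) m≤x rewrite <ᵇ-false (≤⇒≯ m≤x) = refl

pushRight-++ : ∀ m Y₁ Y₂ → All (_< m) Y₁ → StartsAtLeast m Y₂ → pushRight m (Y₁ ++ Y₂) ≡ Y₁ ++ m ∷ Y₂
pushRight-++ m Y₁ Y₂ Y₁<m m≤Y₂ = trans (pushRight-below m Y₁ Y₂ Y₁<m) (cong (Y₁ ++_) (pushRight-stop m Y₂ m≤Y₂))

-- The larger LTR maxima are bubbled first and leave the prefix m ∷ B untouched.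
q-∷ : ∀ m B σ → All (_< m) B → StartsAbove m σ → q (m ∷ B ++ σ) ≡ B ++ pushRight m (q σ)
q-∷ m B σ B<m m<σ = begin
    q (m ∷ B ++ σ)
  ≡⟨ cong (λ ms → bubbleAll (m ∷ B ++ σ) (reverse ms)) (ltrMax-∷ m B σ B<m m<σ) ⟩
    bubbleAll (m ∷ B ++ σ) (reverse (m ∷ ltrMax σ))
  ≡⟨ cong (bubbleAll (m ∷ B ++ σ)) (unfold-reverse m (ltrMax σ)) ⟩
    bubbleAll (m ∷ B ++ σ) (reverse (ltrMax σ) ∷ʳ m)
  ≡⟨ foldl-++ (λ acc v → bubble v acc) (m ∷ B ++ σ) (reverse (ltrMax σ)) [ m ] ⟩
    bubble m (bubbleAll (m ∷ B ++ σ) (reverse (ltrMax σ)))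
  ≡⟨ cong (bubble m) (bubbleAll-skip m B σ (reverse (ltrMax σ)) B<m
                       (All-resp-↭ (↭-sym (↭-reverse (ltrMax σ))) (ltrMax-exceeds m σ m<σ))) ⟩
    bubble m (m ∷ B ++ q σ)
  ≡⟨ cong (λ b → if b then pushRight m (B ++ q σ) else m ∷ bubble m (B ++ q σ)) (≡ᵇ-refl m) ⟩
    pushRight m (B ++ q σ)
  ≡⟨ pushRight-below m B (q σ) B<m ⟩
    B ++ pushRight m (q σ)
  ∎
  where open ≡-Reasoning

pushRight-↭ : ∀ v σ → pushRight v σ ↭ v ∷ σ
pushRight-↭ v []      = ↭-refl
pushRight-↭ v (x ∷ σ) with x <ᵇ v
... | true  = ↭-trans (↭-prep x (pushRight-↭ v σ)) (↭-swap x v ↭-refl)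
... | false = ↭-refl

bubble-↭ : ∀ v σ → bubble v σ ↭ σ
bubble-↭ v []      = ↭-refl
bubble-↭ v (x ∷ σ) with x ≡ᵇ v in eq
... | true rewrite ≡ᵇ⇒≡ x v (Equivalence.from T-≡ eq) = pushRight-↭ v σ
... | false = ↭-prep x (bubble-↭ v σ)

bubbleAll-↭ : ∀ σ vs → bubbleAll σ vs ↭ σ
bubbleAll-↭ σ []       = ↭-refl
bubbleAll-↭ σ (v ∷ vs) = ↭-trans (bubbleAll-↭ (bubble v σ) vs) (bubble-↭ v σ)

q-↭ : ∀ σ → q σ ↭ σ
q-↭ σ = bubbleAll-↭ σ (reverse (ltrMax σ))

-- An enumeration of the preimages

PreimageAbove : ℕ → List ℕ → List ℕ → Set
PreimageAbove t π σ = q σ ≡ π × StartsAbove t σ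

-- x can be the first entry of a preimage, above t, of A ++ x ∷ R
HeadCandidate : ℕ → List ℕ → ℕ → List ℕ → Set
HeadCandidate t A x R = t < x × All (_< x) A × StartsAtLeast x R

startsAtLeast? : ∀ x R → Dec (StartsAtLeast x R)
startsAtLeast? x []      = yes tt
startsAtLeast? x (y ∷ _) = x ≤? y

headCandidate? : ∀ t A x R → Dec (HeadCandidate t A x R)
headCandidate? t A x R = (t <? x) ×-dec (all? (_<? x) A ×-dec startsAtLeast? x R)

onlyIf : {P : Set} → Dec P → List (List ℕ) → List (List ℕ)
onlyIf (yes _) xs = xs
onlyIf (no _)  _  = []

-- The argument f is fuel, sufficient as soon as length π ≤ f.  By q-∷, a preimage of A ++ x ∷ R
-- with first entry x is x ∷ B ++ s, where A = B ++ A′ (B is moved in front of x by the queue)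
-- and s is a preimage above x of A′ ++ R.
mutual
  preimages : ℕ → List ℕ → ℕ → List (List ℕ)
  preimages _       []      _ = [ [] ]
  preimages zero    (_ ∷ _) _ = []
  preimages (suc f) (x ∷ π) t = chooseHead f t [] (x ∷ π)

  chooseHead : ℕ → ℕ → List ℕ → List ℕ → List (List ℕ)
  chooseHead f t A []      = []
  chooseHead f t A (x ∷ R) =
    onlyIf (headCandidate? t A x R) (chooseBlock f x R [] A) ++ chooseHead f t (A ∷ʳ x) R

  chooseBlock : ℕ → ℕ → List ℕ → List ℕ → List ℕ → List (List ℕ)
  chooseBlock f x R B []      = withBlock f x R B []
  chooseBlock f x R B (y ∷ Y) = withBlock f x R B (y ∷ Y) ++ chooseBlock f x R (B ∷ʳ y) Y

  withBlock : ℕ → ℕ → List ℕ → List ℕ → List ℕ → List (List ℕ)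
  withBlock f x R B Y = map (λ s → x ∷ B ++ s) (preimages f (Y ++ R) x)

record BlockPreimage (x : ℕ) (R B Y σ : List ℕ) : Set where
  constructor blockPreimage
  field
    rest : List ℕ
    σ≡   : σ ≡ x ∷ B ++ rest
    q≡   : q σ ≡ (B ++ Y) ++ x ∷ R

mutual
  preimages-sound : ∀ f π t σ → σ ∈ preimages f π t → PreimageAbove t π σ
  preimages-sound f       []      t .[] (here refl) = refl , tt
  preimages-sound (suc f) (x ∷ π) t σ   σ∈          = chooseHead-sound f t [] (x ∷ π) σ σ∈

  chooseHead-sound : ∀ f t A R σ → σ ∈ chooseHead f t A R → PreimageAbove t (A ++ R) σ
  chooseHead-sound f t A (x ∷ R) σ σ∈ with headCandidate? t A x R
  ... | no _ = chooseHead-sound-next f t A x R σ σ∈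
  ... | yes (t<x , A<x , x≤R) with ∈-++⁻ (chooseBlock f x R [] A) σ∈
  ...   | inj₂ σ∈′ = chooseHead-sound-next f t A x R σ σ∈′
  ...   | inj₁ σ∈′ with chooseBlock-sound f x R [] A σ A<x x≤R σ∈′
  ...     | blockPreimage _ refl q≡ = q≡ , t<x

  chooseHead-sound-next : ∀ f t A x R σ → σ ∈ chooseHead f t (A ∷ʳ x) R → PreimageAbove t (A ++ x ∷ R) σ
  chooseHead-sound-next f t A x R σ σ∈ with chooseHead-sound f t (A ∷ʳ x) R σ σ∈
  ... | q≡ , t<σ = trans q≡ (++-assoc A [ x ] R) , t<σ

  chooseBlock-sound : ∀ f x R B Y σ → All (_< x) (B ++ Y) → StartsAtLeast x R →
                      σ ∈ chooseBlock f x R B Y → BlockPreimage x R B Y σ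
  chooseBlock-sound f x R B []      σ BY<x x≤R σ∈ = withBlock-sound f x R B [] σ BY<x x≤R σ∈
  chooseBlock-sound f x R B (y ∷ Y) σ BY<x x≤R σ∈ with ∈-++⁻ (withBlock f x R B (y ∷ Y)) σ∈
  ... | inj₁ σ∈′ = withBlock-sound f x R B (y ∷ Y) σ BY<x x≤R σ∈′
  ... | inj₂ σ∈′ with chooseBlock-sound f x R (B ∷ʳ y) Y σ (subst (All (_< x)) (sym (++-assoc B [ y ] Y)) BY<x) x≤R σ∈′
  ...   | blockPreimage s σ≡ q≡ =
    blockPreimage (y ∷ s) (trans σ≡ (cong (x ∷_) (++-assoc B [ y ] s))) (trans q≡ (cong (_++ x ∷ R) (++-assoc B [ y ] Y)))

  withBlock-sound : ∀ f x R B Y σ → All (_< x) (B ++ Y) → StartsAtLeast x R →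
                    σ ∈ withBlock f x R B Y → BlockPreimage x R B Y σ
  withBlock-sound f x R B Y σ BY<x x≤R σ∈ with ∈-map⁻ (λ s → x ∷ B ++ s) σ∈
  ... | s , s∈ , refl with preimages-sound f (Y ++ R) x s s∈
  ...   | q≡ , x<s = blockPreimage s refl (begin
      q (x ∷ B ++ s)            ≡⟨ q-∷ x B s (++⁻ˡ B BY<x) x<s ⟩
      B ++ pushRight x (q s)    ≡⟨ cong (λ τ → B ++ pushRight x τ) q≡ ⟩
      B ++ pushRight x (Y ++ R) ≡⟨ cong (B ++_) (pushRight-++ x Y R (++⁻ʳ B BY<x) x≤R) ⟩
      B ++ Y ++ x ∷ R           ≡⟨ ++-assoc B Y (x ∷ R) ⟨
      (B ++ Y) ++ x ∷ R         ∎)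
    where open ≡-Reasoning

record SplitBelow (m : ℕ) (xs : List ℕ) : Set where
  constructor splitBelow
  field
    low high : List ℕ
    xs≡      : xs ≡ low ++ high
    low<m    : All (_< m) low
    m≤high   : StartsAtLeast m high

split< : ∀ m xs → SplitBelow m xs
split< m []       = splitBelow [] [] refl [] tt
split< m (x ∷ xs) with x <? m
... | no  x≮m = splitBelow [] (x ∷ xs) refl [] (≮⇒≥ x≮m)
... | yes x<m with split< m xs
...   | splitBelow L H refl L<m m≤H = splitBelow (x ∷ L) H refl (x<m ∷ L<m) m≤H

startsAbove-distinct : ∀ {m} σ → All (m ≢_) σ → StartsAtLeast m σ → StartsAbove m σ
startsAbove-distinct []      _         _   = tt
startsAbove-distinct (_ ∷ _) (m≢x ∷ _) m≤x = ≤∧≢⇒< m≤x m≢x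

unique-++⁻ʳ : ∀ B {σ : List ℕ} → Unique (B ++ σ) → Unique σ
unique-++⁻ʳ []      !σ          = !σ
unique-++⁻ʳ (_ ∷ B) (_ ∷ !B++σ) = unique-++⁻ʳ B !B++σ

length-q : ∀ σ → length (q σ) ≡ length σ
length-q σ = ↭-length (q-↭ σ)

chooseBlock-complete : ∀ f x R B B′ Y s → s ∈ preimages f (Y ++ R) x →
                     (x ∷ B ++ B′ ++ s) ∈ chooseBlock f x R B (B′ ++ Y)
chooseBlock-complete f x R B []       []      s s∈ = ∈-map⁺ (λ s → x ∷ B ++ s) s∈
chooseBlock-complete f x R B []       (_ ∷ _) s s∈ = ∈-++⁺ˡ (∈-map⁺ (λ s → x ∷ B ++ s) s∈)
chooseBlock-complete f x R B (b ∷ B′) Y       s s∈ =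
  ∈-++⁺ʳ (withBlock f x R B (b ∷ B′ ++ Y))
    (subst (_∈ chooseBlock f x R (B ∷ʳ b) (B′ ++ Y)) (cong (x ∷_) (++-assoc B [ b ] (B′ ++ s)))
      (chooseBlock-complete f x R (B ∷ʳ b) B′ Y s s∈))

chooseHead-complete : ∀ f t A A′ x R σ → HeadCandidate t (A ++ A′) x R →
                      σ ∈ chooseBlock f x R [] (A ++ A′) → σ ∈ chooseHead f t A (A′ ++ x ∷ R)
chooseHead-complete f t A [] x R σ cand σ∈ rewrite ++-identityʳ A with headCandidate? t A x R
... | yes _     = ∈-++⁺ˡ σ∈
... | no ¬cand = ⊥-elim (¬cand cand)
chooseHead-complete f t A (a ∷ A′) x R σ cand σ∈ =
  ∈-++⁺ʳ (onlyIf (headCandidate? t A a (A′ ++ x ∷ R)) (chooseBlock f a (A′ ++ x ∷ R) [] A))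
    (chooseHead-complete f t (A ∷ʳ a) A′ x R σ (subst (λ Z → HeadCandidate t Z x R) A++a∷A′ cand)
      (subst (λ Z → σ ∈ chooseBlock f x R [] Z) A++a∷A′ σ∈))
  where A++a∷A′ = sym (++-assoc A [ a ] A′)

chooseHead⊆preimages : ∀ f t π σ → σ ∈ chooseHead f t [] π → σ ∈ preimages (suc f) π t
chooseHead⊆preimages f t (_ ∷ _) σ σ∈ = σ∈
chooseHead⊆preimages f t []      σ ()

preimages-complete : ∀ f π t σ → Unique σ → length π ≤ f → PreimageAbove t π σ → σ ∈ preimages f π t
preimages-complete f π t [] _ _ (refl , _) = here refl
preimages-complete zero π t (m ∷ ρ) _ |π|≤0 (refl , _) with () ← trans (sym (length-q (m ∷ ρ))) (n≤0⇒n≡0 |π|≤0)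
preimages-complete (suc f) π t (m ∷ ρ) (m∉ρ ∷ !ρ) |π|≤ (q≡π , t<m) with split< m ρ
... | splitBelow B σ refl B<m m≤σ with split< m (q σ)
...   | splitBelow Y₁ Y₂ qσ≡ Y₁<m m≤Y₂ =
  subst (λ π → (m ∷ B ++ σ) ∈ preimages (suc f) π t) π≡
    (chooseHead⊆preimages f t ((B ++ Y₁) ++ m ∷ Y₂) _
      (chooseHead-complete f t [] (B ++ Y₁) m Y₂ _ (t<m , ++⁺ B<m Y₁<m , m≤Y₂)
        (chooseBlock-complete f m Y₂ [] B Y₁ σ
          (preimages-complete f (Y₁ ++ Y₂) m σ (unique-++⁻ʳ B !ρ) |qσ|≤f (qσ≡ , m<σ)))))
  where
  m<σ : StartsAbove m σ
  m<σ = startsAbove-distinct σ (++⁻ʳ B m∉ρ) m≤σ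
  π≡ : (B ++ Y₁) ++ m ∷ Y₂ ≡ π
  π≡ = begin
    (B ++ Y₁) ++ m ∷ Y₂         ≡⟨ ++-assoc B Y₁ (m ∷ Y₂) ⟩
    B ++ Y₁ ++ m ∷ Y₂           ≡⟨ cong (B ++_) (pushRight-++ m Y₁ Y₂ Y₁<m m≤Y₂) ⟨
    B ++ pushRight m (Y₁ ++ Y₂) ≡⟨ cong (λ τ → B ++ pushRight m τ) qσ≡ ⟨
    B ++ pushRight m (q σ)     ≡⟨ q-∷ m B σ B<m m<σ ⟨
    q (m ∷ B ++ σ)             ≡⟨ q≡π ⟩
    π                          ∎
    where open ≡-Reasoning
  |qσ|≤f : length (Y₁ ++ Y₂) ≤ f
  |qσ|≤f = begin
    length (Y₁ ++ Y₂)  ≡⟨ cong length qσ≡ ⟨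
    length (q σ)       ≡⟨ length-q σ ⟩
    length σ           ≤⟨ m≤n+m (length σ) (length B) ⟩
    length B + length σ ≡⟨ length-++ B ⟨
    length (B ++ σ)    ≤⟨ s≤s⁻¹ (subst (_≤ suc f) (trans (cong length (sym q≡π)) (length-q (m ∷ B ++ σ))) |π|≤) ⟩
    f                  ∎
    where open ≤-Reasoning

HeadExceeds : List ℕ → List ℕ → Set
HeadExceeds A []      = ⊥
HeadExceeds A (y ∷ _) = All (_< y) A

headExceeds-∷ʳ⁻ : ∀ A {x} σ → HeadExceeds (A ∷ʳ x) σ → HeadExceeds A σ
headExceeds-∷ʳ⁻ A (_ ∷ _) A∷ʳx<y = ++⁻ˡ A A∷ʳx<y

chooseHead-head : ∀ f t A R σ → σ ∈ chooseHead f t A R → HeadExceeds A σ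
chooseHead-head f t A (x ∷ R) σ σ∈ with headCandidate? t A x R
... | no _ = headExceeds-∷ʳ⁻ A σ (chooseHead-head f t (A ∷ʳ x) R σ σ∈)
... | yes (_ , A<x , x≤R) with ∈-++⁻ (chooseBlock f x R [] A) σ∈
...   | inj₂ σ∈′ = headExceeds-∷ʳ⁻ A σ (chooseHead-head f t (A ∷ʳ x) R σ σ∈′)
...   | inj₁ σ∈′ with chooseBlock-sound f x R [] A σ A<x x≤R σ∈′
...     | blockPreimage _ refl _ = A<x

All-∷ʳ⁻ : ∀ {P : ℕ → Set} A {x} → All P (A ∷ʳ x) → P x
All-∷ʳ⁻ A P[A∷ʳx] with ++⁻ʳ A P[A∷ʳx]
... | Px ∷ [] = Px

mutual
  preimages-unique : ∀ f π t → Unique (preimages f π t)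
  preimages-unique f       []      t = [] ∷ []
  preimages-unique zero    (_ ∷ _) t = []
  preimages-unique (suc f) (x ∷ π) t = chooseHead-unique f t [] (x ∷ π)

  chooseHead-unique : ∀ f t A R → Unique (chooseHead f t A R)
  chooseHead-unique f t A []      = []
  chooseHead-unique f t A (x ∷ R) with headCandidate? t A x R
  ... | no _                 = chooseHead-unique f t (A ∷ʳ x) R
  ... | yes (_ , A<x , x≤R) =
    Unique.++⁺ (chooseBlock-unique f x R [] A A<x x≤R) (chooseHead-unique f t (A ∷ʳ x) R) disjoint
    where
    disjoint : Disjoint (chooseBlock f x R [] A) (chooseHead f t (A ∷ʳ x) R)
    disjoint (σ∈ , σ∈′) with chooseBlock-sound f x R [] A _ A<x x≤R σ∈
    ... | blockPreimage _ refl _ = <-irrefl refl (All-∷ʳ⁻ A (chooseHead-head f t (A ∷ʳ x) R _ σ∈′))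

  chooseBlock-unique : ∀ f x R B Y → All (_< x) (B ++ Y) → StartsAtLeast x R → Unique (chooseBlock f x R B Y)
  chooseBlock-unique f x R B []      _    _   = withBlock-unique f x R B []
  chooseBlock-unique f x R B (y ∷ Y) BY<x x≤R =
    Unique.++⁺ (withBlock-unique f x R B (y ∷ Y)) (chooseBlock-unique f x R (B ∷ʳ y) Y By∷Y<x x≤R) disjoint
    where
    By∷Y<x : All (_< x) ((B ∷ʳ y) ++ Y)
    By∷Y<x = subst (All (_< x)) (sym (++-assoc B [ y ] Y)) BY<x
    y<x : y < x
    y<x with ++⁻ʳ B BY<x
    ... | y<x ∷ _ = y<x
    disjoint : Disjoint (withBlock f x R B (y ∷ Y)) (chooseBlock f x R (B ∷ʳ y) Y)
    disjoint (σ∈ , σ∈′) with ∈-map⁻ (λ s → x ∷ B ++ s) σ∈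
    ... | s , s∈ , refl with preimages-sound f (y ∷ Y ++ R) x s s∈
                           | chooseBlock-sound f x R (B ∷ʳ y) Y _ By∷Y<x x≤R σ∈′
    ...   | _ , x<s | blockPreimage s′ σ≡ _ = <-asym y<x (subst (StartsAbove x) s≡y∷s′ x<s)
      where
      s≡y∷s′ : s ≡ y ∷ s′
      s≡y∷s′ = ++-cancelˡ B s (y ∷ s′) (trans (∷-injectiveʳ σ≡) (++-assoc B [ y ] s′))

  withBlock-unique : ∀ f x R B Y → Unique (withBlock f x R B Y)
  withBlock-unique f x R B Y =
    Unique.map⁺ (λ {s} {s′} eq → ++-cancelˡ B s s′ (∷-injectiveʳ eq)) (preimages-unique f (Y ++ R) x)

-- Counting the enumeration

sumUpTo : (ℕ → ℕ) → ℕ → ℕ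
sumUpTo g zero    = g zero
sumUpTo g (suc a) = sumUpTo g a + g (suc a)

ballot : ℕ → ℕ → ℕ
ballot zero    zero    = 1
ballot zero    (suc _) = 0
ballot (suc w) z       = sumUpTo (ballot w) (suc z)

runCount : ℕ → ℕ → ℕ
runCount zero    _ = 0
runCount (suc w) a = ballot (suc w) a

runCount-∷ : ∀ w a → sumUpTo (ballot w) a + runCount w (suc a) ≡ runCount (suc w) a
runCount-∷ zero    a = refl
runCount-∷ (suc w) a = refl

tailCount : ℕ → ℕ → ℕ → ℕ
tailCount u p b = runCount u (b + suc p)

chainCount : (ℕ → ℕ) → ℕ → ℕ → ℕ
chainCount b zero    a = b a
chainCount b (suc y) a = sumUpTo (chainCount b y) a + chainCount b y (suc a)

length-∷ʳ : ∀ (A : List ℕ) x → length (A ∷ʳ x) ≡ suc (length A)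
length-∷ʳ A x = trans (length-++-sucʳ A x []) (cong (suc ∘ length) (++-identityʳ A))

fuel-∷ʳ : ∀ {n} A x (R : List ℕ) → length (A ++ x ∷ R) ≤ n → length ((A ∷ʳ x) ++ R) ≤ n
fuel-∷ʳ A x R = subst (_≤ _) (cong length (sym (++-assoc A [ x ] R)))

fuel-block : ∀ {f} A x (R S : List ℕ) → length (A ++ x ∷ R) ≤ suc f → length S ≤ length A → length (S ++ R) ≤ f
fuel-block {f} A x R S fuel |S|≤|A| = begin
  length (S ++ R)     ≡⟨ length-++ S ⟩
  length S + length R ≤⟨ +-monoˡ-≤ (length R) |S|≤|A| ⟩
  length A + length R ≡⟨ length-++ A ⟨
  length (A ++ R)     ≤⟨ s≤s⁻¹ (subst (_≤ suc f) (length-++-sucʳ A x R) fuel) ⟩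
  f                   ∎
  where open ≤-Reasoning

length-chooseBlock : ∀ f x R B Y (g : ℕ → ℕ) → All (_< x) Y →
                     (∀ S → All (_< x) S → length S ≤ length Y → length (preimages f (S ++ R) x) ≡ g (length S)) →
                     length (chooseBlock f x R B Y) ≡ sumUpTo g (length Y)
length-chooseBlock f x R B []      g _           count = trans (length-map _ (preimages f R x)) (count [] [] z≤n)
length-chooseBlock f x R B (y ∷ Y) g (y<x ∷ Y<x) count = begin
    length (withBlock f x R B (y ∷ Y) ++ chooseBlock f x R (B ∷ʳ y) Y)
  ≡⟨ length-++ (withBlock f x R B (y ∷ Y)) ⟩
    length (withBlock f x R B (y ∷ Y)) + length (chooseBlock f x R (B ∷ʳ y) Y)
  ≡⟨ cong₂ _+_ (trans (length-map _ (preimages f (y ∷ Y ++ R) x)) (count (y ∷ Y) (y<x ∷ Y<x) ≤-refl))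
               (length-chooseBlock f x R (B ∷ʳ y) Y g Y<x (λ S S<x |S|≤ → count S S<x (m≤n⇒m≤1+n |S|≤))) ⟩
    g (suc (length Y)) + sumUpTo g (length Y)
  ≡⟨ +-comm (g (suc (length Y))) _ ⟩
    sumUpTo g (suc (length Y))
  ∎
  where open ≡-Reasoning

Blocked : ℕ → List ℕ → ℕ → Set
Blocked t A z = ¬ (t < z × All (_< z) A)

chooseHead-skip : ∀ f t A Z R → All (Blocked t A) Z → chooseHead f t A (Z ++ R) ≡ chooseHead f t (A ++ Z) R
chooseHead-skip f t A []      R []                  = cong (λ A → chooseHead f t A R) (sym (++-identityʳ A))
chooseHead-skip f t A (z ∷ Z) R (z-blocked ∷ Z-blocked) with headCandidate? t A z (Z ++ R)
... | yes (t<z , A<z , _) = ⊥-elim (z-blocked (t<z , A<z))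
... | no _ = trans (chooseHead-skip f t (A ∷ʳ z) Z R (All.map blocked-∷ʳ Z-blocked))
                   (cong (λ A → chooseHead f t A R) (++-assoc A [ z ] Z))
  where
  blocked-∷ʳ : ∀ {y} → Blocked t A y → Blocked t (A ∷ʳ z) y
  blocked-∷ʳ A-blocks (t<y , A∷ʳz<y) = A-blocks (t<y , ++⁻ˡ A A∷ʳz<y)

preimages-below : ∀ f x X R → All (_< x) X → X ++ R ≢ [] → preimages (suc f) (X ++ R) x ≡ chooseHead f x X R
preimages-below f x []      []      _   X++R≢[] = ⊥-elim (X++R≢[] refl)
preimages-below f x []      (_ ∷ _) _   _       = refl
preimages-below f x (z ∷ X) R       X<x _       =
  chooseHead-skip f x [] (z ∷ X) R (All.map (λ z<x (x<z , _) → <-asym z<x x<z) X<x)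

ascending⇒startsAtLeast : ∀ {x} W → Ascending x W → StartsAtLeast x W
ascending⇒startsAtLeast []      _           = tt
ascending⇒startsAtLeast (_ ∷ _) (x<w ∷ _)   = <⇒≤ x<w

All-≤-< : ∀ {u x A} → All (_≤ u) A → u < x → All (_< x) A
All-≤-< A≤u u<x = All.map (λ a≤u → ≤-<-trans a≤u u<x) A≤u

All-≤-∷ʳ : ∀ {u x} A → All (_≤ u) A → u < x → All (_≤ x) (A ∷ʳ x)
All-≤-∷ʳ A A≤u u<x = ++⁺ (All.map <⇒≤ (All-≤-< A≤u u<x)) (≤-refl ∷ [])

BallotCount : ℕ → Set
BallotCount f = ∀ Z W x → All (_< x) Z → Ascending x W → length (Z ++ W) ≤ f →
                length (preimages f (Z ++ W) x) ≡ ballot (length W) (length Z)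

length-chooseHead-run : ∀ f t u A W → BallotCount f → All (_≤ u) A → t ≤ u → Ascending u W →
                        length (A ++ W) ≤ suc f → length (chooseHead f t A W) ≡ runCount (length W) (length A)
length-chooseHead-run f t u A []      _     _   _   _              _    = refl
length-chooseHead-run f t u A (x ∷ W) count A≤u t≤u (u<x ∷ x<W) fuel with headCandidate? t A x W
... | no ¬cand = ⊥-elim (¬cand (≤-<-trans t≤u u<x , All-≤-< A≤u u<x , ascending⇒startsAtLeast W x<W))
... | yes _ = begin
    length (chooseBlock f x W [] A ++ chooseHead f t (A ∷ʳ x) W)
  ≡⟨ length-++ (chooseBlock f x W [] A) ⟩
    length (chooseBlock f x W [] A) + length (chooseHead f t (A ∷ʳ x) W)
  ≡⟨ cong₂ _+_
       (length-chooseBlock f x W [] A (ballot (length W)) (All-≤-< A≤u u<x)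
          (λ S S<x |S|≤|A| → count S W x S<x x<W (fuel-block A x W S fuel |S|≤|A|)))
       (length-chooseHead-run f t x (A ∷ʳ x) W count (All-≤-∷ʳ A A≤u u<x) (≤-trans t≤u (<⇒≤ u<x)) x<W
          (fuel-∷ʳ A x W fuel)) ⟩
    sumUpTo (ballot (length W)) (length A) + runCount (length W) (length (A ∷ʳ x))
  ≡⟨ cong (λ n → sumUpTo (ballot (length W)) (length A) + runCount (length W) n) (length-∷ʳ A x) ⟩
    sumUpTo (ballot (length W)) (length A) + runCount (length W) (suc (length A))
  ≡⟨ runCount-∷ (length W) (length A) ⟩
    runCount (suc (length W)) (length A)
  ∎
  where open ≡-Reasoning

++-∷≢[] : ∀ (A : List ℕ) {x R} → A ++ x ∷ R ≢ []
++-∷≢[] A eq with () ← ++-conicalʳ A _ eq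

length-preimages-ballot : ∀ f → BallotCount f
length-preimages-ballot f       []      []      x _   _   _    = refl
length-preimages-ballot zero    (_ ∷ _) _       x _   _   ()
length-preimages-ballot zero    []      (_ ∷ _) x _   _   ()
length-preimages-ballot (suc f) (z ∷ Z) []      x Z<x _   _    = cong length (preimages-below f x (z ∷ Z) [] Z<x (λ ()))
length-preimages-ballot (suc f) Z       (w ∷ W) x Z<x x<W fuel =
  trans (cong length (preimages-below f x Z (w ∷ W) Z<x (++-∷≢[] Z)))
        (length-chooseHead-run f x x Z (w ∷ W) (length-preimages-ballot f) (All.map <⇒≤ Z<x) ≤-refl x<W fuel)

ascending-∷ʳ⇒startsAtLeast : ∀ {x a} Y R → Ascending x (Y ∷ʳ a) → StartsAtLeast x ((Y ∷ʳ a) ++ R)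
ascending-∷ʳ⇒startsAtLeast []      R (x<a ∷ _) = <⇒≤ x<a
ascending-∷ʳ⇒startsAtLeast (_ ∷ _) R (x<y ∷ _) = <⇒≤ x<y

below⇒¬startsAtLeast : ∀ {a} P R → All (_< a) P → P ≢ [] → ¬ StartsAtLeast a (P ++ R)
below⇒¬startsAtLeast []      R _         P≢[] _   = P≢[] refl
below⇒¬startsAtLeast (_ ∷ _) R (p<a ∷ _) _    a≤p = <⇒≱ p<a a≤p

-- Lists X ++ M₁ ++ P₁ ++ M₂ in LTR-max shape, with M₁ = Y ∷ʳ a, P₁ = P and M₂ = U.  The first entry
-- of a preimage lies in Y or in U: a exceeds the entry after it, and the entries of P are below a.
module ShapeCount {a : ℕ} {P U : List ℕ} (P<a : All (_< a) P) (P≢[] : P ≢ []) (a<U : Ascending a U) where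

  shapeCount : ℕ → ℕ → ℕ
  shapeCount = chainCount (tailCount (length U) (length P))

  ShapeCountAt : ℕ → Set
  ShapeCountAt f = ∀ X Y x → All (_< x) X → Ascending x (Y ∷ʳ a) → length (X ++ (Y ∷ʳ a) ++ P ++ U) ≤ f →
                   length (preimages f (X ++ (Y ∷ʳ a) ++ P ++ U) x) ≡ shapeCount (length Y) (length X)

  length-chooseHead-chain : ∀ f t u A Y → ShapeCountAt f → BallotCount f → All (_≤ u) A → t ≤ u →
                            Ascending u (Y ∷ʳ a) → length (A ++ (Y ∷ʳ a) ++ P ++ U) ≤ suc f →
                            length (chooseHead f t A ((Y ∷ʳ a) ++ P ++ U)) ≡ shapeCount (length Y) (length A)
  length-chooseHead-chain f t u A [] _ ballots A≤u t≤u (u<a ∷ _) fuel with headCandidate? t A a (P ++ U)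
  ... | yes (_ , _ , a≤P++U) = ⊥-elim (below⇒¬startsAtLeast P U P<a P≢[] a≤P++U)
  ... | no _ = begin
      length (chooseHead f t (A ∷ʳ a) (P ++ U))
    ≡⟨ cong length (chooseHead-skip f t (A ∷ʳ a) P U
                      (All.map (λ p<a (_ , A∷ʳa<p) → <-asym p<a (All-∷ʳ⁻ A A∷ʳa<p)) P<a)) ⟩
      length (chooseHead f t ((A ∷ʳ a) ++ P) U)
    ≡⟨ length-chooseHead-run f t a ((A ∷ʳ a) ++ P) U ballots A∷ʳa++P≤a (≤-trans t≤u (<⇒≤ u<a)) a<U
         (subst (_≤ suc f) (cong length (sym (++-assoc (A ∷ʳ a) P U))) (fuel-∷ʳ A a (P ++ U) fuel)) ⟩
      runCount (length U) (length ((A ∷ʳ a) ++ P))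
    ≡⟨ cong (runCount (length U)) (trans (length-++ (A ∷ʳ a)) (trans (cong (_+ length P) (length-∷ʳ A a))
                                                                     (sym (+-suc (length A) (length P))))) ⟩
      tailCount (length U) (length P) (length A)
    ∎
    where
    open ≡-Reasoning
    A∷ʳa++P≤a : All (_≤ a) ((A ∷ʳ a) ++ P)
    A∷ʳa++P≤a = ++⁺ (All-≤-∷ʳ A A≤u u<a) (All.map <⇒≤ P<a)
  length-chooseHead-chain f t u A (y ∷ Y) shapes ballots A≤u t≤u (u<y ∷ y<Y∷ʳa) fuel
    with headCandidate? t A y ((Y ∷ʳ a) ++ P ++ U)
  ... | no ¬cand =
    ⊥-elim (¬cand (≤-<-trans t≤u u<y , All-≤-< A≤u u<y , ascending-∷ʳ⇒startsAtLeast Y (P ++ U) y<Y∷ʳa))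
  ... | yes _ = begin
      length (chooseBlock f y R [] A ++ chooseHead f t (A ∷ʳ y) R)
    ≡⟨ length-++ (chooseBlock f y R [] A) ⟩
      length (chooseBlock f y R [] A) + length (chooseHead f t (A ∷ʳ y) R)
    ≡⟨ cong₂ _+_
         (length-chooseBlock f y R [] A (shapeCount (length Y)) (All-≤-< A≤u u<y)
            (λ S S<y |S|≤|A| → shapes S Y y S<y y<Y∷ʳa (fuel-block A y R S fuel |S|≤|A|)))
         (length-chooseHead-chain f t y (A ∷ʳ y) Y shapes ballots (All-≤-∷ʳ A A≤u u<y) (≤-trans t≤u (<⇒≤ u<y))
            y<Y∷ʳa (fuel-∷ʳ A y R fuel)) ⟩
      sumUpTo (shapeCount (length Y)) (length A) + shapeCount (length Y) (length (A ∷ʳ y))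
    ≡⟨ cong (λ n → sumUpTo (shapeCount (length Y)) (length A) + shapeCount (length Y) n) (length-∷ʳ A y) ⟩
      shapeCount (suc (length Y)) (length A)
    ∎
    where
    open ≡-Reasoning
    R = (Y ∷ʳ a) ++ P ++ U

  length-preimages : ∀ f → ShapeCountAt f
  length-preimages zero    (_ ∷ _) _       x _ _ ()
  length-preimages zero    []      (_ ∷ _) x _ _ ()
  length-preimages zero    []      []      x _ _ ()
  length-preimages (suc f) X       Y       x X<x x<Y∷ʳa fuel =
    trans (cong length (preimages-below f x X ((Y ∷ʳ a) ++ P ++ U) X<x
                         (λ eq → ++-∷≢[] Y (++-conicalˡ (Y ∷ʳ a) _ (++-conicalʳ X _ eq)))))
          (length-chooseHead-chain f x x X Y (length-preimages f) (length-preimages-ballot f)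
             (All.map <⇒≤ X<x) ≤-refl x<Y∷ʳa fuel)

-- Binomial coefficients and Catalan numbers

binom : ℕ → ℕ → ℕ
binom n       zero    = 1
binom zero    (suc k) = 0
binom (suc n) (suc k) = binom n k + binom n (suc k)

binom≡C : ∀ n k → binom n k ≡ n C k
binom≡C n       zero    = refl
binom≡C zero    (suc k) = refl
binom≡C (suc n) (suc k) = trans (cong₂ _+_ (binom≡C n k) (binom≡C n (suc k))) (nCk+nC[k+1]≡[n+1]C[k+1] n k)

-- binomPrev n k is binom n (k ∸ 1) without the junk value at k = 0
binomPrev : ℕ → ℕ → ℕ
binomPrev n zero    = 0
binomPrev n (suc k) = binom n k

binom-pascal : ∀ n k → binom (suc n) k ≡ binomPrev n k + binom n k
binom-pascal n zero    = refl
binom-pascal n (suc k) = refl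

binom-absorption : ∀ n k → suc k * binom n (suc k) + k * binom n k ≡ n * binom n k
binom-absorption zero    zero    = refl
binom-absorption zero    (suc k) = cong₂ _+_ (*-zeroʳ (suc (suc k))) (*-zeroʳ (suc k))
binom-absorption (suc n) zero    = begin
    1 * binom (suc n) 1 + 0 ≡⟨ cong (λ b → 1 * b + 0) (trans (binom≡C (suc n) 1) (nC1≡n (suc n))) ⟩
    1 * suc n + 0           ≡⟨ trans (+-identityʳ _) (trans (*-identityˡ _) (sym (*-identityʳ _))) ⟩
    suc n * 1               ∎
  where open ≡-Reasoning
binom-absorption (suc n) (suc k) = begin
    suc (suc k) * (y + z) + suc k * (x + y)
  ≡⟨ regroup₁ k x y z ⟩
    (suc (suc k) * z + suc k * y) + suc (suc k) * y + suc k * x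
  ≡⟨ cong (λ e → e + suc (suc k) * y + suc k * x) (binom-absorption n (suc k)) ⟩
    n * y + suc (suc k) * y + suc k * x
  ≡⟨ regroup₂ n k x y ⟩
    (suc k * y + k * x) + x + n * y + y
  ≡⟨ cong (λ e → e + x + n * y + y) (binom-absorption n k) ⟩
    n * x + x + n * y + y
  ≡⟨ regroup₃ n x y ⟩
    suc n * (x + y)
  ∎
  where
  open ≡-Reasoning
  x = binom n k
  y = binom n (suc k)
  z = binom n (suc (suc k))
  regroup₁ : ∀ k x y z → suc (suc k) * (y + z) + suc k * (x + y) ≡ (suc (suc k) * z + suc k * y) + suc (suc k) * y + suc k * x
  regroup₁ = solve-∀
  regroup₂ : ∀ n k x y → n * y + suc (suc k) * y + suc k * x ≡ (suc k * y + k * x) + x + n * y + y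
  regroup₂ = solve-∀
  regroup₃ : ∀ n x y → n * x + x + n * y + y ≡ suc n * (x + y)
  regroup₃ = solve-∀

binom-central : ∀ w → binom (suc (w + w)) (suc w) ≡ binom (suc (w + w)) w
binom-central w = begin
  binom (suc (w + w)) (suc w)  ≡⟨ binom≡C (suc (w + w)) (suc w) ⟩
  suc (w + w) C suc w          ≡⟨ nCk≡nC[n∸k] (s≤s (m≤n+m w w)) ⟩
  suc (w + w) C (w + w ∸ w)    ≡⟨ cong (suc (w + w) C_) (m+n∸n≡m w w) ⟩
  suc (w + w) C w              ≡⟨ binom≡C (suc (w + w)) w ⟨
  binom (suc (w + w)) w        ∎
  where open ≡-Reasoning

sumUpTo-ballot-zero : ∀ a → sumUpTo (ballot 0) a ≡ 1
sumUpTo-ballot-zero zero    = refl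
sumUpTo-ballot-zero (suc a) = trans (+-identityʳ _) (sumUpTo-ballot-zero a)

ballot-one : ∀ z → ballot 1 z ≡ 1
ballot-one z = sumUpTo-ballot-zero (suc z)

-- width w z = 2w + z + 1, by a recursion on w that follows the one of ballot
width : ℕ → ℕ → ℕ
width zero    z = suc z
width (suc w) z = width w (suc (suc z))

width-suc : ∀ w z → width w (suc z) ≡ suc (width w z)
width-suc zero    z = refl
width-suc (suc w) z = width-suc w (suc (suc z))

width-zero : ∀ w → width w 0 ≡ suc (w + w)
width-zero zero    = refl
width-zero (suc w) = begin
  width w 2                   ≡⟨ trans (width-suc w 1) (cong suc (width-suc w 0)) ⟩
  suc (suc (width w 0))       ≡⟨ cong (suc ∘ suc) (width-zero w) ⟩
  suc (suc (suc (w + w)))     ≡⟨ cong (suc ∘ suc) (+-suc w w) ⟨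
  suc (suc (w + suc w))       ∎
  where open ≡-Reasoning

ballot-binom-first : ∀ {G₀ G₁} w → let n = suc (w + w) in
                     G₀ + binomPrev n w ≡ binom n w → G₁ + binomPrev (suc n) w ≡ binom (suc n) w →
                     G₀ + G₁ + binom (suc (suc n)) w ≡ binom (suc (suc n)) (suc w)
ballot-binom-first {G₀} {G₁} w ballot₀ ballot₁ = begin
    G₀ + G₁ + binom (suc (suc n)) w
  ≡⟨ cong (G₀ + G₁ +_) (binom-pascal (suc n) w) ⟩
    G₀ + G₁ + (binomPrev (suc n) w + binom (suc n) w)
  ≡⟨ regroup₁ G₀ G₁ (binomPrev (suc n) w) (binom (suc n) w) ⟩
    G₀ + (G₁ + binomPrev (suc n) w) + binom (suc n) w
  ≡⟨ cong (λ e → G₀ + e + binom (suc n) w) ballot₁ ⟩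
    G₀ + binom (suc n) w + binom (suc n) w
  ≡⟨ cong (λ e → G₀ + e + binom (suc n) w) (binom-pascal n w) ⟩
    G₀ + (binomPrev n w + binom n w) + binom (suc n) w
  ≡⟨ regroup₂ G₀ (binomPrev n w) (binom n w) (binom (suc n) w) ⟩
    binom (suc n) w + ((G₀ + binomPrev n w) + binom n w)
  ≡⟨ cong (λ e → binom (suc n) w + (e + binom n w)) ballot₀ ⟩
    binom (suc n) w + (binom n w + binom n w)
  ≡⟨ cong (λ e → binom (suc n) w + (binom n w + e)) (binom-central w) ⟨
    binom (suc (suc n)) (suc w)
  ∎
  where
  open ≡-Reasoning
  n = suc (w + w)
  regroup₁ : ∀ a b c d → a + b + (c + d) ≡ a + (b + c) + d
  regroup₁ = solve-∀
  regroup₂ : ∀ a b c d → a + (b + c) + d ≡ d + ((a + b) + c)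
  regroup₂ = solve-∀

ballot-binom-next : ∀ {G G′} K w → G′ + binomPrev K w ≡ binom K w → G + binom K w ≡ binom K (suc w) →
                    G + G′ + binom (suc K) w ≡ binom (suc K) (suc w)
ballot-binom-next {G} {G′} K w ballot′ ballot = begin
    G + G′ + binom (suc K) w
  ≡⟨ cong (G + G′ +_) (binom-pascal K w) ⟩
    G + G′ + (binomPrev K w + binom K w)
  ≡⟨ regroup G G′ (binomPrev K w) (binom K w) ⟩
    (G′ + binomPrev K w) + (G + binom K w)
  ≡⟨ cong₂ _+_ ballot′ ballot ⟩
    binom K w + binom K (suc w)
  ∎
  where
  open ≡-Reasoning
  regroup : ∀ a b c d → a + b + (c + d) ≡ (b + c) + (a + d)
  regroup = solve-∀

-- ballot (w + 1) z = C(2w+z+1, w) − C(2w+z+1, w−1), the entries of Catalan's triangle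
ballot-binom : ∀ w z → ballot (suc w) z + binomPrev (width w z) w ≡ binom (width w z) w
ballot-binom zero    z       = trans (+-identityʳ _) (ballot-one z)
ballot-binom (suc w) zero    =
  subst (λ m → ballot (suc (suc w)) 0 + binom m w ≡ binom m (suc w)) (sym width-2)
    (ballot-binom-first w (subst (λ m → ballot (suc w) 0 + binomPrev m w ≡ binom m w) (width-zero w) (ballot-binom w 0))
                          (subst (λ m → ballot (suc w) 1 + binomPrev m w ≡ binom m w) width-1 (ballot-binom w 1)))
  where
  width-1 : width w 1 ≡ suc (suc (w + w))
  width-1 = trans (width-suc w 0) (cong suc (width-zero w))
  width-2 : width w 2 ≡ suc (suc (suc (w + w)))
  width-2 = trans (width-suc w 1) (cong suc width-1)
ballot-binom (suc w) (suc z) =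
  subst (λ m → ballot (suc (suc w)) (suc z) + binom m w ≡ binom m (suc w)) (sym (width-suc w (suc (suc z))))
    (ballot-binom-next (width w (suc (suc z))) w (ballot-binom w (suc (suc z))) (ballot-binom (suc w) z))

ballot-central : ∀ w → ballot (suc w) 0 * suc (suc w) ≡ binom (suc (suc (w + w))) (suc w)
ballot-central zero    = refl
ballot-central (suc k) = begin
    G * suc (suc w)
  ≡⟨ +-cancelʳ-≡ _ _ _ (begin
       G * suc (suc w) + suc k * a        ≡⟨ cong (G * suc (suc w) +_) k+1*a≡k+3*b ⟩
       G * suc (suc w) + suc (suc w) * b  ≡⟨ factor G b ⟩
       suc (suc w) * (G + b)              ≡⟨ cong (suc (suc w) *_) G+b≡a ⟩
       suc (suc w) * a                    ≡⟨ split a ⟩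
       (a + a) + suc k * a                ∎) ⟩
    a + a
  ≡⟨ cong (a +_) (binom-central w) ⟨
    binom (suc n) (suc w)
  ∎
  where
  open ≡-Reasoning
  w = suc k
  n = suc (w + w)
  G = ballot (suc w) 0
  a = binom n w
  b = binom n k
  G+b≡a : G + b ≡ a
  G+b≡a = subst (λ m → G + binomPrev m w ≡ binom m w) (width-zero w) (ballot-binom w 0)
  k+1*a≡k+3*b : suc k * a ≡ suc (suc w) * b
  k+1*a≡k+3*b = +-cancelʳ-≡ _ _ _ (trans (binom-absorption n k) (n≡k+3+k k b))
    where
    n≡k+3+k : ∀ k b → suc (suc k + suc k) * b ≡ suc (suc (suc k)) * b + k * b
    n≡k+3+k = solve-∀
  factor : ∀ G b → G * suc (suc w) + suc (suc w) * b ≡ suc (suc w) * (G + b)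
  factor G b = factor′ G b k
    where
    factor′ : ∀ G b k → G * suc (suc (suc k)) + suc (suc (suc k)) * b ≡ suc (suc (suc k)) * (G + b)
    factor′ = solve-∀
  split : ∀ a → suc (suc w) * a ≡ (a + a) + suc k * a
  split a = split′ a k
    where
    split′ : ∀ a k → suc (suc (suc k)) * a ≡ (a + a) + suc k * a
    split′ = solve-∀

ballot-catalan : ∀ w → ballot w 0 ≡ catalan w
ballot-catalan zero    = refl
ballot-catalan (suc w) = sym (begin
  ((2 * suc w) C suc w) / suc (suc w)             ≡⟨ cong (λ m → (m C suc w) / suc (suc w)) (two-suc w) ⟩
  (suc (suc (w + w)) C suc w) / suc (suc w)       ≡⟨ cong (_/ suc (suc w)) (binom≡C (suc (suc (w + w))) (suc w)) ⟨
  binom (suc (suc (w + w))) (suc w) / suc (suc w) ≡⟨ cong (_/ suc (suc w)) (ballot-central w) ⟨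
  (ballot (suc w) 0 * suc (suc w)) / suc (suc w)  ≡⟨ m*n/n≡m (ballot (suc w) 0) (suc (suc w)) ⟩
  ballot (suc w) 0                                ∎)
  where
  open ≡-Reasoning
  two-suc : ∀ w → 2 * suc w ≡ suc (suc (w + w))
  two-suc = solve-∀

-- Closed forms for |M₂| = 2 and |M₂| = 3

sumUpTo-cong : ∀ {g h} → (∀ x → g x ≡ h x) → ∀ a → sumUpTo g a ≡ sumUpTo h a
sumUpTo-cong g≡h zero    = g≡h zero
sumUpTo-cong g≡h (suc a) = cong₂ _+_ (sumUpTo-cong g≡h a) (g≡h (suc a))

sumUpTo-+ : ∀ g h a → sumUpTo (λ x → g x + h x) a ≡ sumUpTo g a + sumUpTo h a
sumUpTo-+ g h zero    = refl
sumUpTo-+ g h (suc a) = trans (cong (_+ (g (suc a) + h (suc a))) (sumUpTo-+ g h a))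
                              (+-interchange (sumUpTo g a) (sumUpTo h a) (g (suc a)) (h (suc a)))

sumUpTo-* : ∀ c g a → sumUpTo (λ x → c * g x) a ≡ c * sumUpTo g a
sumUpTo-* c g zero    = refl
sumUpTo-* c g (suc a) = trans (cong (_+ c * g (suc a)) (sumUpTo-* c g a)) (sym (*-distribˡ-+ c (sumUpTo g a) (g (suc a))))

Chainlike : (ℕ → ℕ → ℕ) → Set
Chainlike L = ∀ y a → L (suc y) a ≡ sumUpTo (L y) a + L y (suc a)

chainCount-unique : ∀ b L → Chainlike L → (∀ a → b a ≡ L 0 a) → ∀ y a → chainCount b y a ≡ L y a
chainCount-unique b L L-chain base zero    a = base a
chainCount-unique b L L-chain base (suc y) a =
  trans (cong₂ _+_ (sumUpTo-cong (chainCount-unique b L L-chain base y) a) (chainCount-unique b L L-chain base y (suc a)))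
        (sym (L-chain y a))

ballot-chainlike : ∀ (h : ℕ → ℕ) → (∀ y → h (suc y) ≡ suc (h y)) → Chainlike (λ y → ballot (h y))
ballot-chainlike h h-suc y a = cong (λ m → ballot m a) (h-suc y)

chainlike-+ : ∀ L M → Chainlike L → Chainlike M → Chainlike (λ y a → L y a + M y a)
chainlike-+ L M L-chain M-chain y a = begin
    L (suc y) a + M (suc y) a
  ≡⟨ cong₂ _+_ (L-chain y a) (M-chain y a) ⟩
    (sumUpTo (L y) a + L y (suc a)) + (sumUpTo (M y) a + M y (suc a))
  ≡⟨ +-interchange (sumUpTo (L y) a) (L y (suc a)) (sumUpTo (M y) a) (M y (suc a)) ⟩
    (sumUpTo (L y) a + sumUpTo (M y) a) + (L y (suc a) + M y (suc a))
  ≡⟨ cong (_+ (L y (suc a) + M y (suc a))) (sumUpTo-+ (L y) (M y) a) ⟨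
    sumUpTo (λ x → L y x + M y x) a + (L y (suc a) + M y (suc a))
  ∎
  where open ≡-Reasoning

chainlike-* : ∀ c L → Chainlike L → Chainlike (λ y a → c * L y a)
chainlike-* c L L-chain y a = begin
    c * L (suc y) a
  ≡⟨ cong (c *_) (L-chain y a) ⟩
    c * (sumUpTo (L y) a + L y (suc a))
  ≡⟨ *-distribˡ-+ c (sumUpTo (L y) a) (L y (suc a)) ⟩
    c * sumUpTo (L y) a + c * L y (suc a)
  ≡⟨ cong (_+ c * L y (suc a)) (sumUpTo-* c (L y) a) ⟨
    sumUpTo (λ x → c * L y x) a + c * L y (suc a)
  ∎
  where open ≡-Reasoning

sumUpTo-ballot-one : ∀ a → sumUpTo (ballot 1) a ≡ suc a
sumUpTo-ballot-one zero    = refl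
sumUpTo-ballot-one (suc a) = trans (cong₂ _+_ (sumUpTo-ballot-one a) (ballot-one (suc a))) (+-comm (suc a) 1)

ballot-two : ∀ z → ballot 2 z ≡ z + 2
ballot-two z = trans (sumUpTo-ballot-one (suc z)) (+-comm 2 z)

chainCount-two : ∀ p y → chainCount (tailCount 2 p) y 0 ≡ catalan (suc y + 1) + (p + 1) * catalan (suc y)
chainCount-two p y = begin
    chainCount (tailCount 2 p) y 0
  ≡⟨ chainCount-unique _ L L-chain base y 0 ⟩
    ballot (suc y + 1) 0 + (p + 1) * ballot (suc y) 0
  ≡⟨ cong₂ (λ c d → c + (p + 1) * d) (ballot-catalan (suc y + 1)) (ballot-catalan (suc y)) ⟩
    catalan (suc y + 1) + (p + 1) * catalan (suc y)
  ∎
  where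
  open ≡-Reasoning
  L : ℕ → ℕ → ℕ
  L y a = ballot (suc y + 1) a + (p + 1) * ballot (suc y) a
  L-chain : Chainlike L
  L-chain = chainlike-+ _ _ (ballot-chainlike (λ y → suc y + 1) (λ _ → refl))
                            (chainlike-* (p + 1) _ (ballot-chainlike suc (λ _ → refl)))
  base : ∀ a → runCount 2 (a + suc p) ≡ L 0 a
  base a = begin
    ballot 2 (a + suc p)           ≡⟨ ballot-two (a + suc p) ⟩
    a + suc p + 2                  ≡⟨ regroup a p ⟩
    a + 2 + (p + 1) * 1            ≡⟨ cong₂ (λ c d → c + (p + 1) * d) (ballot-two a) (ballot-one a) ⟨
    ballot 2 a + (p + 1) * ballot 1 a ∎
    where
    regroup : ∀ a p → a + suc p + 2 ≡ a + 2 + (p + 1) * 1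
    regroup = solve-∀

sumUpTo-ballot-two-split : ∀ a p → sumUpTo (ballot 2) (suc (suc (p + a))) ≡
                           sumUpTo (ballot 2) (suc a) + suc p * (a + 2) + sumUpTo (ballot 2) p
sumUpTo-ballot-two-split a zero    = begin
    sumUpTo (ballot 2) (suc a) + ballot 2 (suc (suc a)) ≡⟨ cong (sumUpTo (ballot 2) (suc a) +_) (ballot-two (suc (suc a))) ⟩
    sumUpTo (ballot 2) (suc a) + (suc (suc a) + 2)      ≡⟨ regroup (sumUpTo (ballot 2) (suc a)) a ⟩
    sumUpTo (ballot 2) (suc a) + 1 * (a + 2) + 2        ∎
  where
  open ≡-Reasoning
  regroup : ∀ s a → s + (suc (suc a) + 2) ≡ s + 1 * (a + 2) + 2
  regroup = solve-∀
sumUpTo-ballot-two-split a (suc p) = begin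
    sumUpTo (ballot 2) (suc (suc (p + a))) + ballot 2 (suc (suc (suc (p + a))))
  ≡⟨ cong₂ _+_ (sumUpTo-ballot-two-split a p) (ballot-two (suc (suc (suc (p + a))))) ⟩
    S₁ + suc p * (a + 2) + Sₚ + (suc (suc (suc (p + a))) + 2)
  ≡⟨ regroup S₁ Sₚ a p ⟩
    S₁ + suc (suc p) * (a + 2) + (Sₚ + (suc p + 2))
  ≡⟨ cong (λ e → S₁ + suc (suc p) * (a + 2) + (Sₚ + e)) (ballot-two (suc p)) ⟨
    S₁ + suc (suc p) * (a + 2) + (Sₚ + ballot 2 (suc p))
  ∎
  where
  open ≡-Reasoning
  S₁ = sumUpTo (ballot 2) (suc a)
  Sₚ = sumUpTo (ballot 2) p
  regroup : ∀ s t a p → s + suc p * (a + 2) + t + (suc (suc (suc (p + a))) + 2) ≡ s + suc (suc p) * (a + 2) + (t + (suc p + 2))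
  regroup = solve-∀

double-sumUpTo-ballot-two : ∀ p → 2 * sumUpTo (ballot 2) p ≡ (p + 1) * (p + 4)
double-sumUpTo-ballot-two zero    = refl
double-sumUpTo-ballot-two (suc p) = begin
    2 * (sumUpTo (ballot 2) p + ballot 2 (suc p))
  ≡⟨ cong (λ e → 2 * (sumUpTo (ballot 2) p + e)) (ballot-two (suc p)) ⟩
    2 * (sumUpTo (ballot 2) p + (suc p + 2))
  ≡⟨ *-distribˡ-+ 2 (sumUpTo (ballot 2) p) (suc p + 2) ⟩
    2 * sumUpTo (ballot 2) p + 2 * (suc p + 2)
  ≡⟨ cong (_+ 2 * (suc p + 2)) (double-sumUpTo-ballot-two p) ⟩
    (p + 1) * (p + 4) + 2 * (suc p + 2)
  ≡⟨ regroup p ⟩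
    (suc p + 1) * (suc p + 4)
  ∎
  where
  open ≡-Reasoning
  regroup : ∀ p → (p + 1) * (p + 4) + 2 * (suc p + 2) ≡ (suc p + 1) * (suc p + 4)
  regroup = solve-∀

chainCount-three : ∀ p y → 2 * chainCount (tailCount 3 p) y 0 ≡
                   2 * catalan (suc y + 2) + 2 * ((p + 1) * catalan (suc y + 1)) + (p + 1) * (p + 4) * catalan (suc y)
chainCount-three p y = begin
    2 * chainCount (tailCount 3 p) y 0
  ≡⟨ cong (2 *_) (chainCount-unique _ L L-chain base y 0) ⟩
    2 * (ballot (suc y + 2) 0 + (p + 1) * ballot (suc y + 1) 0 + Sₚ * ballot (suc y) 0)
  ≡⟨ cong (2 *_) (cong₂ _+_ (cong₂ (λ c d → c + (p + 1) * d) (ballot-catalan (suc y + 2)) (ballot-catalan (suc y + 1)))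
                            (cong (Sₚ *_) (ballot-catalan (suc y)))) ⟩
    2 * (catalan (suc y + 2) + (p + 1) * catalan (suc y + 1) + Sₚ * catalan (suc y))
  ≡⟨ expand (catalan (suc y + 2)) (catalan (suc y + 1)) (catalan (suc y)) (p + 1) Sₚ ⟩
    2 * catalan (suc y + 2) + 2 * ((p + 1) * catalan (suc y + 1)) + (2 * Sₚ) * catalan (suc y)
  ≡⟨ cong (λ e → 2 * catalan (suc y + 2) + 2 * ((p + 1) * catalan (suc y + 1)) + e * catalan (suc y))
          (double-sumUpTo-ballot-two p) ⟩
    2 * catalan (suc y + 2) + 2 * ((p + 1) * catalan (suc y + 1)) + (p + 1) * (p + 4) * catalan (suc y)
  ∎
  where
  open ≡-Reasoning
  Sₚ = sumUpTo (ballot 2) p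
  L : ℕ → ℕ → ℕ
  L y a = ballot (suc y + 2) a + (p + 1) * ballot (suc y + 1) a + Sₚ * ballot (suc y) a
  L-chain : Chainlike L
  L-chain = chainlike-+ _ _ (chainlike-+ _ _ (ballot-chainlike (λ y → suc y + 2) (λ _ → refl))
                                             (chainlike-* (p + 1) _ (ballot-chainlike (λ y → suc y + 1) (λ _ → refl))))
                            (chainlike-* Sₚ _ (ballot-chainlike suc (λ _ → refl)))
  base : ∀ a → runCount 3 (a + suc p) ≡ L 0 a
  base a = begin
    sumUpTo (ballot 2) (suc (a + suc p))
      ≡⟨ cong (sumUpTo (ballot 2) ∘ suc) (trans (+-suc a p) (cong suc (+-comm a p))) ⟩
    sumUpTo (ballot 2) (suc (suc (p + a)))
      ≡⟨ sumUpTo-ballot-two-split a p ⟩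
    ballot 3 a + suc p * (a + 2) + Sₚ
      ≡⟨ regroup (ballot 3 a) a p Sₚ ⟩
    ballot 3 a + (p + 1) * (a + 2) + Sₚ * 1
      ≡⟨ cong₂ (λ c d → ballot 3 a + (p + 1) * c + Sₚ * d) (ballot-two a) (ballot-one a) ⟨
    L 0 a ∎
    where
    regroup : ∀ b a p s → b + suc p * (a + 2) + s ≡ b + (p + 1) * (a + 2) + s * 1
    regroup = solve-∀
  expand : ∀ c d e q s → 2 * (c + q * d + s * e) ≡ 2 * c + 2 * (q * d) + (2 * s) * e
  expand = solve-∀

-- The LTR-max decomposition

ltrMaxGo-⊆ : ∀ m l {x} → x ∈ ltrMaxGo (just m) l → x ∈ l
ltrMaxGo-⊆ m (y ∷ l) x∈ with m <ᵇ y
ltrMaxGo-⊆ m (y ∷ l) (here x≡y)  | true  = here x≡y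
ltrMaxGo-⊆ m (y ∷ l) (there x∈′) | true  = there (ltrMaxGo-⊆ y l x∈′)
ltrMaxGo-⊆ m (y ∷ l) x∈          | false = there (ltrMaxGo-⊆ m l x∈)

ltrMaxGo≡∷⇒∈ : ∀ m l {x r} → ltrMaxGo (just m) l ≡ x ∷ r → x ∈ l
ltrMaxGo≡∷⇒∈ m l eq = ltrMaxGo-⊆ m l (subst (_ ∈_) (sym eq) (here refl))

ltrMaxGo≡id⇒ascending : ∀ m U → Unique (m ∷ U) → ltrMaxGo (just m) U ≡ U → Ascending m U
ltrMaxGo≡id⇒ascending m []      _            _  = [-]
ltrMaxGo≡id⇒ascending m (u ∷ U) (_ ∷ !u∷U) eq with m <ᵇ u in m<ᵇu
... | true  = <ᵇ⇒< m u (Equivalence.from T-≡ m<ᵇu) ∷ ltrMaxGo≡id⇒ascending u U !u∷U (∷-injectiveʳ eq)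
... | false = ⊥-elim (Unique[x∷xs]⇒x∉xs !u∷U (ltrMaxGo≡∷⇒∈ m U eq))

ltrMaxGo≡suffix⇒shape : ∀ m P U → Unique (m ∷ P ++ U) → ltrMaxGo (just m) (P ++ U) ≡ U → All (_< m) P × Ascending m U
ltrMaxGo≡suffix⇒shape m []      U !m∷U eq = [] , ltrMaxGo≡id⇒ascending m U !m∷U eq
ltrMaxGo≡suffix⇒shape m (p ∷ P) U !m∷p∷P++U eq with m <ᵇ p in m<ᵇp
ltrMaxGo≡suffix⇒shape m (p ∷ P) []      _                    ()  | true
ltrMaxGo≡suffix⇒shape m (p ∷ P) (u ∷ U) (_ ∷ (p∉P++U ∷ _)) eq | true =
  ⊥-elim (All.lookup p∉P++U (∈-++⁺ʳ P (here (∷-injectiveˡ eq))) refl)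
ltrMaxGo≡suffix⇒shape m (p ∷ P) U ((m≢p ∷ m∉P++U) ∷ (_ ∷ !P++U)) eq | false
  with ltrMaxGo≡suffix⇒shape m P U (m∉P++U ∷ !P++U) eq
... | P<m , m<U = ≤∧≢⇒< (≮⇒≥ m≮p) (≢-sym m≢p) ∷ P<m , m<U
  where m≮p = λ m<p → subst T m<ᵇp (<⇒<ᵇ m<p)

ltrMaxGo≡⇒shape : ∀ m Y a P U → Unique (m ∷ (Y ∷ʳ a) ++ P ++ U) →
                  ltrMaxGo (just m) ((Y ∷ʳ a) ++ P ++ U) ≡ (Y ∷ʳ a) ++ U →
                  Ascending m (Y ∷ʳ a) × All (_< a) P × Ascending a U
ltrMaxGo≡⇒shape m []      a P U (_ ∷ !a∷P++U) eq with m <ᵇ a in m<ᵇa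
... | true with ltrMaxGo≡suffix⇒shape a P U !a∷P++U (∷-injectiveʳ eq)
...   | P<a , a<U = <ᵇ⇒< m a (Equivalence.from T-≡ m<ᵇa) ∷ [-] , P<a , a<U
ltrMaxGo≡⇒shape m []      a P U (_ ∷ !a∷P++U) eq | false =
  ⊥-elim (Unique[x∷xs]⇒x∉xs !a∷P++U (ltrMaxGo≡∷⇒∈ m (P ++ U) eq))
ltrMaxGo≡⇒shape m (y ∷ Y) a P U (_ ∷ !y∷rest) eq with m <ᵇ y in m<ᵇy
... | true with ltrMaxGo≡⇒shape y Y a P U !y∷rest (∷-injectiveʳ eq)
...   | y<Y∷ʳa , P<a , a<U = <ᵇ⇒< m y (Equivalence.from T-≡ m<ᵇy) ∷ y<Y∷ʳa , P<a , a<U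
ltrMaxGo≡⇒shape m (y ∷ Y) a P U (_ ∷ !y∷rest) eq | false =
  ⊥-elim (Unique[x∷xs]⇒x∉xs !y∷rest (ltrMaxGo≡∷⇒∈ m ((Y ∷ʳ a) ++ P ++ U) eq))

record LTRShape (M₁ P₁ M₂ : List ℕ) : Set where
  constructor ltrShape
  field
    init         : List ℕ
    last         : ℕ
    M₁≡          : M₁ ≡ init ∷ʳ last
    M₁-ascending : Ascending 0 (init ∷ʳ last)
    P₁<last      : All (_< last) P₁
    M₂-ascending : Ascending last M₂

ltrMax≡ltrMaxGo0 : ∀ π → All (0 ≢_) π → ltrMax π ≡ ltrMaxGo (just 0) π
ltrMax≡ltrMaxGo0 []      _           = refl
ltrMax≡ltrMaxGo0 (x ∷ π) (0≢x ∷ _) rewrite <ᵇ-true (n≢0⇒n>0 (≢-sym 0≢x)) = refl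

All-<0⇒[] : ∀ {P} → All (_< 0) P → P ≡ []
All-<0⇒[] [] = refl

-- Unique (0 ∷ π) says that π has distinct positive entries, so that 0 serves as a sentinel running maximum.
ltrMax-shape : ∀ M₁ P₁ M₂ → Unique (0 ∷ M₁ ++ P₁ ++ M₂) → ltrMax (M₁ ++ P₁ ++ M₂) ≡ M₁ ++ M₂ → P₁ ≢ [] →
               LTRShape M₁ P₁ M₂
ltrMax-shape M₁ P₁ M₂ !0∷π@(0∉π ∷ _) eq P₁≢[] with initLast M₁ | trans (sym (ltrMax≡ltrMaxGo0 _ 0∉π)) eq
... | []      | eq₀ = ⊥-elim (P₁≢[] (All-<0⇒[] (proj₁ (ltrMaxGo≡suffix⇒shape 0 P₁ M₂ !0∷π eq₀))))
... | Y ∷ʳ′ a | eq₀ with ltrMaxGo≡⇒shape 0 Y a P₁ M₂ !0∷π eq₀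
...   | 0<Y∷ʳa , P₁<a , a<M₂ = ltrShape Y a refl 0<Y∷ʳa P₁<a a<M₂

IsPerm⇒Unique : ∀ {n σ} → IsPerm n σ → Unique σ
IsPerm⇒Unique σ↭ = ↭ₛ.Unique-resp-↭ (↭⇒↭ₛ (↭-sym σ↭)) (Unique.map⁺ suc-injective (Unique.upTo⁺ _))

IsPerm⇒positive : ∀ {n σ} → IsPerm n σ → All (0 <_) σ
IsPerm⇒positive σ↭ = All-resp-↭ (↭-sym σ↭) (map⁺ (All.universal (λ _ → z<s) _))

positive⇒startsAbove0 : ∀ {σ} → All (0 <_) σ → StartsAbove 0 σ
positive⇒startsAbove0 []        = tt
positive⇒startsAbove0 (0<x ∷ _) = 0<x

preimages-enumerate : ∀ {n π} → IsPerm n π → EnumPreimage n π (preimages (length π) π 0)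
preimages-enumerate {n} {π} π↭ = preimages-unique (length π) π 0 , λ σ → mk⇔ (sound σ) (complete σ)
  where
  sound : ∀ σ → σ ∈ preimages (length π) π 0 → IsPerm n σ × q σ ≡ π
  sound σ σ∈ with preimages-sound (length π) π 0 σ σ∈
  ... | q≡π , _ = ↭-trans (↭-sym (q-↭ σ)) (subst (_↭ _) (sym q≡π) π↭) , q≡π
  complete : ∀ σ → IsPerm n σ × q σ ≡ π → σ ∈ preimages (length π) π 0
  complete σ (σ↭ , q≡π) =
    preimages-complete (length π) π 0 σ (IsPerm⇒Unique σ↭) ≤-refl (q≡π , positive⇒startsAbove0 (IsPerm⇒positive σ↭))

enumerations-length : ∀ {n π L L′} → EnumPreimage n π L → EnumPreimage n π L′ → length L ≡ length L′
enumerations-length (!L , L-mem) (!L′ , L′-mem) =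
  ↭-length (∼bag⇒↭ (unique∧set⇒bag !L !L′ (λ {σ} → ⇔-sym (L′-mem σ) ⇔-∘ L-mem σ)))

count-preimages : ∀ {n π} → IsPerm n π → ∀ M₁ P₁ M₂ → π ≡ M₁ ++ P₁ ++ M₂ → ltrMax π ≡ M₁ ++ M₂ → P₁ ≢ [] →
                  Σ ℕ λ y → length M₁ ≡ suc y ×
                    (∀ L → EnumPreimage n π L → length L ≡ chainCount (tailCount (length M₂) (length P₁)) y 0)
count-preimages π∈Sₙ M₁ P₁ M₂ refl ltr P₁≢[]
  with ltrMax-shape M₁ P₁ M₂ (All.map <⇒≢ (IsPerm⇒positive π∈Sₙ) ∷ IsPerm⇒Unique π∈Sₙ) ltr P₁≢[]
... | ltrShape Y a refl 0<M₁ P₁<a a<M₂ = length Y , length-∷ʳ Y a , λ L L-enum →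
  trans (enumerations-length L-enum (preimages-enumerate π∈Sₙ))
        (ShapeCount.length-preimages P₁<a P₁≢[] a<M₂ _ [] Y 0 [] 0<M₁ ≤-refl)

corollary4p20 : (n : ℕ) (π : List ℕ) → IsPerm n π →
    (M₁ P₁ M₂ : List ℕ) → π ≡ M₁ ++ P₁ ++ M₂ → ltrMax π ≡ M₁ ++ M₂ → P₁ ≢ [] →
    ((length M₂ ≡ 2 → (L : List (List ℕ)) → EnumPreimage n π L →
        length L ≡ catalan (length M₁ + 1) + (length P₁ + 1) * catalan (length M₁))
    × (length M₂ ≡ 3 → (L : List (List ℕ)) → EnumPreimage n π L →
        2 * length L ≡ 2 * catalan (length M₁ + 2) + 2 * ((length P₁ + 1) * catalan (length M₁ + 1))
                         + (length P₁ + 1) * (length P₁ + 4) * catalan (length M₁)))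
corollary4p20 n π π∈Sₙ M₁ P₁ M₂ π≡ ltr P₁≢[] with count-preimages π∈Sₙ M₁ P₁ M₂ π≡ ltr P₁≢[]
... | y , |M₁|≡1+y , count = two , three
  where
  two : length M₂ ≡ 2 → (L : List (List ℕ)) → EnumPreimage n π L →
        length L ≡ catalan (length M₁ + 1) + (length P₁ + 1) * catalan (length M₁)
  two |M₂|≡2 L L-enum rewrite |M₁|≡1+y | count L L-enum | |M₂|≡2 = chainCount-two (length P₁) y
  three : length M₂ ≡ 3 → (L : List (List ℕ)) → EnumPreimage n π L →
          2 * length L ≡ 2 * catalan (length M₁ + 2) + 2 * ((length P₁ + 1) * catalan (length M₁ + 1))
                         + (length P₁ + 1) * (length P₁ + 4) * catalan (length M₁)
  three |M₂|≡3 L L-enum rewrite |M₁|≡1+y | count L L-enum | |M₂|≡3 = chainCount-three (length P₁) y
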